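{- For every state predicate $U$, variable $x$ and expression $e$, the trace predicates $\langle U\rangle$, $U[x\mapsto e]$ and $\mathrm{dup}(U)$ are setoid predicates. For any setoid trace predicates $P,Q$, the trace predicate $P \ast\ast Q$ is a setoid predicate. For any setoid trace predicate $P$, the trace predicate $P^{\dagger}$ is a setoid predicate. Moreover, $\mathit{finite}$ and $\mathit{infinite}$ are setoid predicates.
   Context: The metatheory is constructive. A state $\sigma$ assigns an integer to each (integer) variable; for an arithmetic expression $e$ over variables, $[\![e]\!]\sigma$ is its value in $\sigma$, and $\sigma[x\mapsto v]$ is $\sigma$ with $x$ updated to $v$. Traces are defined coinductively: for every state $\sigma$, $\langle\sigma\rangle$ is a trace, and if $\tau$ is a trace then $\sigma::\tau$ is a trace (nonempty, possibly infinite sequences of states). Bisimilarity $\approx$ is defined coinductively by $\langle\sigma\rangle\approx\langle\sigma\rangle$ and $\sigma::\tau\approx\sigma::\tau'$ whenever $\tau\approx\tau'$. $\mathit{hd}\langle\sigma\rangle=\mathit{hd}(\sigma::\tau)=\sigma$. The relation $\tau\downarrow\sigma$ ($\tau$ is finite with last state $\sigma$) is inductive: $\langle\sigma\rangle\downarrow\sigma$, and $\sigma::\tau\downarrow\sigma'$ if $\tau\downarrow\sigma'$. The predicate "$\tau$ is infinite" is coinductive: $\sigma::\tau$ is infinite if $\tau$ is infinite. A trace predicate is a setoid predicate if whenever it holds of $\tau$ and $\tau\approx\tau'$, it holds of $\tau'$. Assertion connectives: $\langle U\rangle$ holds exactly of the traces $\langle\sigma\rangle$ with $\sigma$ satisfying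 $U$; $\mathrm{dup}(U)$ holds exactly of the traces $\sigma::\langle\sigma\rangle$ with $\sigma$ satisfying $U$; $U[x\mapsto e]$ holds exactly of the traces $\sigma::\langle\sigma[x\mapsto[\![e]\!]\sigma]\rangle$ with $\sigma$ satisfying $U$. For a trace predicate $Q$, the relation $\mathrm{follows}_Q(\tau,\tau')$ is defined coinductively by: $\mathrm{follows}_Q(\langle\sigma\rangle,\tau)$ if $\mathit{hd}\,\tau=\sigma$ and $\tau$ satisfies $Q$; $\mathrm{follows}_Q(\sigma::\tau,\sigma::\tau')$ if $\mathrm{follows}_Q(\tau,\tau')$. The chop $P\ast\ast Q$ holds of $\tau'$ iff there is $\tau$ satisfying $P$ with $\mathrm{follows}_Q(\tau,\tau')$. The iteration $P^{\dagger}$ is defined coinductively: $\tau$ satisfies $P^{\dagger}$ if $\tau$ satisfies $\langle\mathsf{true}\rangle$; $\tau'$ satisfies $P^{\dagger}$ if there is $\tau$ satisfying $P$ with $\mathrm{follows}_{P^{\dagger}}(\tau,\tau')$. $\mathit{finite}$ holds of $\tau$ iff $\tau\downarrow\sigma$ for some $\sigma$; $\mathit{infinite}$ holds of $\tau$ iff $\tau$ is infinite. -}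

module Defs where

open import Level using (Level; _⊔_; suc; zero)
open import Data.Nat using (ℕ; _≟_) renaming (suc to sucℕ)
open import Data.Integer using (ℤ; _+_; _-_; _*_)
open import Data.Bool using (Bool; true; false)
open import Data.Unit using (⊤)
open import Data.Sum using (_⊎_)
open import Data.Product using (Σ; _×_; _,_; proj₁; proj₂)
open import Relation.Nullary using (yes; no)
open import Relation.Binary.PropositionalEquality using (_≡_)

Var : Set
Var = ℕ

State : Set
State = Var → ℤ

data Expr : Set where
  con  : ℤ → Expr
  var  : Var → Expr
  _⊕_  : Expr → Expr → Expr
  _⊖_  : Expr → Expr → Expr
  _⊗_  : Expr → Expr → Expr

⟦_⟧ : Expr → State → ℤ
⟦ con n ⟧ σ = n
⟦ var x ⟧ σ = σ x
⟦ e ⊕ f ⟧ σ = ⟦ e ⟧ σ + ⟦ f ⟧ σ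
⟦ e ⊖ f ⟧ σ = ⟦ e ⟧ σ - ⟦ f ⟧ σ
⟦ e ⊗ f ⟧ σ = ⟦ e ⟧ σ * ⟦ f ⟧ σ

_[_≔_] : State → Var → ℤ → State
(σ [ x ≔ v ]) y with y ≟ x
... | yes _ = v
... | no  _ = σ y

-- Coinductive types are unavailable (no --guardedness), so a
-- trace is encoded as a stream of (state , is-last) pairs: the trace
-- ends at the first position whose flag is true; if no flag is true it
-- is infinite.  Entries after the end are irrelevant.  Traces are only
-- ever inspected through the one-step destructor 'out', which exposes
-- exactly the two constructor forms ⟨σ⟩ and σ :: τ.

Trace : Set
Trace = ℕ → State × Bool

⟨_⟩ : State → Trace
⟨ σ ⟩ _ = σ , true

_∷_ : State → Trace → Trace
(σ ∷ τ) 0 = σ , false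
(σ ∷ τ) (sucℕ n) = τ n

data View : Set where
  end  : State → View
  step : State → Trace → View

outAux : State → Bool → Trace → View
outAux σ true  τ = end σ
outAux σ false τ = step σ (λ n → τ (sucℕ n))

out : Trace → View
out τ = outAux (proj₁ (τ 0)) (proj₂ (τ 0)) τ

hd : Trace → State
hd τ = proj₁ (τ 0)

-- Coinductive relations, encoded as greatest fixed points: a relation
-- holds iff it is contained in some post-fixed point of its generating
-- functor.

data BisimF (R : Trace → Trace → Set) : View → View → Set where
  b-end  : ∀ {σ} → BisimF R (end σ) (end σ)
  b-step : ∀ {σ τ τ'} → R τ τ' → BisimF R (step σ τ) (step σ τ')

_≈_ : Trace → Trace → Set₁
τ ≈ τ' = Σ (Trace → Trace → Set) λ R →
  R τ τ' × (∀ a b → R a b → BisimF R (out a) (out b))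

data Fin↓ : View → State → Set where
  ↓-end  : ∀ {σ} → Fin↓ (end σ) σ
  ↓-step : ∀ {σ σ' τ} → Fin↓ (out τ) σ' → Fin↓ (step σ τ) σ'

_↓_ : Trace → State → Set
τ ↓ σ = Fin↓ (out τ) σ

data InfF (X : Trace → Set) : View → Set where
  inf-step : ∀ {σ τ} → X τ → InfF X (step σ τ)

Infinite : Trace → Set₁
Infinite τ = Σ (Trace → Set) λ X → X τ × (∀ a → X a → InfF X (out a))

StatePred : Set₁
StatePred = State → Set

TracePred : (ℓ : Level) → Set (suc ℓ)
TracePred ℓ = Trace → Set ℓ

IsSetoidPred : ∀ {ℓ} → TracePred ℓ → Set (suc zero ⊔ ℓ)
IsSetoidPred P = ∀ {τ τ'} → P τ → τ ≈ τ' → P τ'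

data ⟪_⟫V (U : StatePred) : View → Set where
  ⟪⟫-intro : ∀ {σ} → U σ → ⟪ U ⟫V (end σ)

⟪_⟫ : StatePred → TracePred zero
⟪ U ⟫ τ = ⟪ U ⟫V (out τ)

data IsEnd : View → State → Set where
  is-end : ∀ {σ} → IsEnd (end σ) σ

data DupV (U : StatePred) : View → Set where
  dup-intro : ∀ {σ τ} → U σ → IsEnd (out τ) σ → DupV U (step σ τ)

Dup : StatePred → TracePred zero
Dup U τ = DupV U (out τ)

data UpdV (U : StatePred) (x : Var) (e : Expr) : View → Set where
  upd-intro : ∀ {σ τ} → U σ → IsEnd (out τ) (σ [ x ≔ ⟦ e ⟧ σ ]) → UpdV U x e (step σ τ)

Upd : StatePred → Var → Expr → TracePred zero
Upd U x e τ = UpdV U x e (out τ)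

data FolS {ℓ} (R : Trace → Trace → Set ℓ) (σ : State) (τ : Trace) : View → Set ℓ where
  fol-s : ∀ {τ'} → R τ τ' → FolS R σ τ (step σ τ')

data FolF {ℓ} (Q : TracePred ℓ) (R : Trace → Trace → Set ℓ) : View → Trace → Set ℓ where
  fol-end  : ∀ {σ τ} → hd τ ≡ σ → Q τ → FolF Q R (end σ) τ
  fol-step : ∀ {σ τ τ'} → FolS R σ τ (out τ') → FolF Q R (step σ τ) τ'

Follows : ∀ {ℓ} → TracePred ℓ → Trace → Trace → Set (suc ℓ)
Follows {ℓ} Q τ τ' = Σ (Trace → Trace → Set ℓ) λ R →
  R τ τ' × (∀ a b → R a b → FolF Q R (out a) b)

_**_ : ∀ {ℓ₁ ℓ₂} → TracePred ℓ₁ → TracePred ℓ₂ → TracePred (ℓ₁ ⊔ suc ℓ₂)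
(P ** Q) τ' = Σ Trace λ τ → P τ × Follows Q τ τ'

IterF : ∀ {ℓ} → TracePred ℓ → TracePred ℓ → TracePred (suc ℓ)
IterF P X τ' = ⟪ (λ _ → ⊤) ⟫ τ' ⊎ Σ Trace (λ τ → P τ × Follows X τ τ')

_† : ∀ {ℓ} → TracePred ℓ → TracePred (suc ℓ)
_† {ℓ} P τ = Σ (TracePred ℓ) λ X → X τ × (∀ τ' → X τ' → IterF P X τ')

finite : TracePred zero
finite τ = Σ State λ σ → τ ↓ σ

infinite : TracePred (suc zero)
infinite = Infinite

-- A proof of τ ≈ τ' is a bisimulation R (a post-fixed point of the
-- bisimilarity functor) relating τ and τ'.  The argument has two kinds
-- of steps.
--   * Predicates read off the one-step view of a trace (⟨U⟩, dup(U),
--     U[x ↦ e], and the inductive τ ↓ σ) are transported along one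
--     unfolding BisimF R of the bisimulation ('setoid-from-view'); for
--     ↓ this is an induction on the finiteness proof.
--   * Coinductive predicates are transported by transporting their
--     witnesses: the image of a post-fixed point X under R is again a
--     post-fixed point ('infinite' and P†), and a follows-witness Rf
--     composed with R is again a follows-witness ('follows-transport').
module Submission where

open import Defs
open import Level using (Level)
open import Data.Product using (_×_; Σ; _,_; proj₂)
open import Data.Sum using (inj₁; inj₂)
open import Data.Bool using (Bool; true; false)
open import Relation.Binary.PropositionalEquality using (_≡_; refl; trans; sym)

IsBisimulation : (Trace → Trace → Set) → Set
IsBisimulation R = ∀ a b → R a b → BisimF R (out a) (out b)

Image : ∀ {ℓ} → (Trace → Trace → Set) → TracePred ℓ → TracePred ℓ
Image R X c = Σ Trace λ b → X b × R b c

-- Relational composition (the library's version is named with the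
-- reserved symbol ';' and cannot be referred to).
_⨾_ : ∀ {ℓ} → (Trace → Trace → Set ℓ) → (Trace → Trace → Set) → Trace → Trace → Set ℓ
(S ⨾ R) a c = Σ Trace λ b → S a b × R b c

hdV : View → State
hdV (end σ)    = σ
hdV (step σ _) = σ

hdV-outAux : ∀ σ (last : Bool) τ → hdV (outAux σ last τ) ≡ σ
hdV-outAux σ true  τ = refl
hdV-outAux σ false τ = refl

hdV-out : ∀ τ → hdV (out τ) ≡ hd τ
hdV-out τ = hdV-outAux (hd τ) (proj₂ (τ 0)) τ

hdV-BisimF : ∀ {R v w} → BisimF R v w → hdV v ≡ hdV w
hdV-BisimF b-end       = refl
hdV-BisimF (b-step _)  = refl

bisimulation-hd : ∀ {R} → IsBisimulation R → ∀ {b c} → R b c → hd b ≡ hd c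
bisimulation-hd isBisim {b} {c} r =
  trans (sym (hdV-out b)) (trans (hdV-BisimF (isBisim b c r)) (hdV-out c))

setoid-from-view : ∀ {ℓ} (A : View → Set ℓ) →
  (∀ {R} → IsBisimulation R → ∀ {v w} → BisimF R v w → A v → A w) →
  IsSetoidPred (λ τ → A (out τ))
setoid-from-view A transfer p (R , r , isBisim) = transfer isBisim (isBisim _ _ r) p

⟪⟫-transfer : ∀ {U R v w} → BisimF R v w → ⟪ U ⟫V v → ⟪ U ⟫V w
⟪⟫-transfer b-end p = p

isEnd-transfer : ∀ {R v w σ} → BisimF R v w → IsEnd v σ → IsEnd w σ
isEnd-transfer b-end p = p

dup-transfer : ∀ {U R} → IsBisimulation R →
  ∀ {v w} → BisimF R v w → DupV U v → DupV U w
dup-transfer isBisim (b-step r) (dup-intro u e) =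
  dup-intro u (isEnd-transfer (isBisim _ _ r) e)

upd-transfer : ∀ {U x e R} → IsBisimulation R →
  ∀ {v w} → BisimF R v w → UpdV U x e v → UpdV U x e w
upd-transfer isBisim (b-step r) (upd-intro u e) =
  upd-intro u (isEnd-transfer (isBisim _ _ r) e)

fin-transfer : ∀ {R} → IsBisimulation R →
  ∀ {v w σ} → BisimF R v w → Fin↓ v σ → Fin↓ w σ
fin-transfer isBisim b-end      p          = p
fin-transfer isBisim (b-step r) (↓-step p) = ↓-step (fin-transfer isBisim (isBisim _ _ r) p)

infinite-image : ∀ {R X} → IsBisimulation R →
  (∀ a → X a → InfF X (out a)) → ∀ c → Image R X c → InfF (Image R X) (out c)
infinite-image {R} isBisim isInf c (a , xa , r) = unfold (isBisim a c r) (isInf a xa)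
  where
  unfold : ∀ {v w} → BisimF R v w → InfF _ v → InfF (Image R _) w
  unfold (b-step r') (inf-step x) = inf-step (_ , x , r')

module _ {ℓ} {R : Trace → Trace → Set} (isBisim : IsBisimulation R)
         {Q Q' : TracePred ℓ} (Q⇒Q' : ∀ {b c} → Q b → R b c → Q' c) where

  folS-transfer : ∀ {Rf : Trace → Trace → Set ℓ} {σ τ v w} →
    FolS Rf σ τ v → BisimF R v w → FolS (Rf ⨾ R) σ τ w
  folS-transfer (fol-s rf) (b-step r) = fol-s (_ , rf , r)

  follows-transport : ∀ {τ b c} → Follows Q τ b → R b c → Follows Q' τ c
  follows-transport {b = b} (Rf , rf , isFol) r = (Rf ⨾ R) , (b , rf , r) , isFol'
    where
    isFol' : ∀ a c → (Rf ⨾ R) a c → FolF Q' (Rf ⨾ R) (out a) c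
    isFol' a c (b , rf , r) with out a | isFol a b rf
    ... | _ | fol-end hd≡ q = fol-end (trans (sym (bisimulation-hd isBisim r)) hd≡) (Q⇒Q' q r)
    ... | _ | fol-step s    = fol-step (folS-transfer s (isBisim b c r))

-- Chop respects bisimilarity: keep the P-part, transport the follows-part.
chop-setoid : ∀ {ℓ₁ ℓ₂} (P : TracePred ℓ₁) (Q : TracePred ℓ₂) →
  IsSetoidPred Q → IsSetoidPred (P ** Q)
chop-setoid P Q setoidQ (τ , p , fol) (R , r , isBisim) =
  τ , p , follows-transport isBisim (λ q r' → setoidQ q (R , r' , isBisim)) fol r

-- Iteration respects bisimilarity: the image of an iteration witness X
-- under R is again an iteration witness (P itself need not be a setoid
-- predicate, since the P-parts are kept unchanged).
iteration-setoid : ∀ {ℓ} (P : TracePred ℓ) → IsSetoidPred (P †)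
iteration-setoid P (X , x , isIter) (R , r , isBisim) = Image R X , (_ , x , r) , isIter'
  where
  isIter' : ∀ c → Image R X c → IterF P (Image R X) c
  isIter' c (b , xb , r') with isIter b xb
  ... | inj₁ stop          = inj₁ (⟪⟫-transfer (isBisim b c r') stop)
  ... | inj₂ (τ , p , fol) = inj₂ (τ , p , follows-transport isBisim (λ q r'' → _ , q , r'') fol r')

infinite-setoid : IsSetoidPred infinite
infinite-setoid (X , x , isInf) (R , r , isBisim) =
  Image R X , (_ , x , r) , infinite-image isBisim isInf

proposition3p1 : ∀ {ℓ₁ ℓ₂ ℓ₃ : Level} →
    ((U : StatePred) → IsSetoidPred ⟪ U ⟫)
    × ((U : StatePred) (x : Var) (e : Expr) → IsSetoidPred (Upd U x e))
    × ((U : StatePred) → IsSetoidPred (Dup U))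
    × ((P : TracePred ℓ₁) (Q : TracePred ℓ₂) → IsSetoidPred P → IsSetoidPred Q → IsSetoidPred (P ** Q))
    × ((P : TracePred ℓ₃) → IsSetoidPred P → IsSetoidPred (P †))
    × IsSetoidPred finite
    × IsSetoidPred infinite
proposition3p1 =
    (λ U → setoid-from-view ⟪ U ⟫V (λ _ → ⟪⟫-transfer))
  , (λ U x e → setoid-from-view (UpdV U x e) upd-transfer)
  , (λ U → setoid-from-view (DupV U) dup-transfer)
  , (λ P Q _ setoidQ → chop-setoid P Q setoidQ)
  , (λ P _ → iteration-setoid P)
  , setoid-from-view (λ v → Σ State (Fin↓ v))
      (λ isBisim b (σ , p) → σ , fin-transfer isBisim b p)
  , infinite-setoid
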